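{- Let $\mathbf E=(E,+,{}',0,1)$ be a monotonous effect algebra with induced order $\leq$. Let $\mathbb C(\mathbf E)=(E,\leq,\odot,\rightarrow,{}',0,1)$ where $x\odot y:=(x'+y')'$ (defined iff $x'\leq y$) and $x\rightarrow y:=\{x'+u\mid u\in L(x,y)\}$, and let $\mathbb E(\mathbb C(\mathbf E))=(E,\oplus,{}',0,1)$ where $x\oplus y:=(x'\odot y')'$, defined if and only if $x\leq y'$. Then $\mathbb E(\mathbb C(\mathbf E))=\mathbf E$, i.e. for all $a,b\in E$, $a\oplus b$ is defined iff $a+b$ is defined, and in this case $a\oplus b=a+b$.
   Context: An effect algebra is a partial algebra $(E,+,{}',0,1)$ of type $(2,1,0,0)$ where $(E,{}',0,1)$ is an algebra and $+$ is a partial binary operation such that for all $x,y,z\in E$: (E1) $x+y$ is defined iff $y+x$ is defined, and then $x+y=y+x$; (E2) $(x+y)+z$ is defined iff $x+(y+z)$ is defined, and then they are equal; (E3) $x'$ is the unique $u\in E$ with $x+u=1$; (E4) if $1+x$ is defined then $x=0$. The induced order is $x\leq y$ iff there is $z\in E$ with $x+z=y$. For a poset and $A\subseteq E$: $L(A)=\{x\mid x\leq y\ \forall y\in A\}$, $U(A)=\{x\mid y\leq x\ \forall y\in A\}$, $L(a,b)=L(\{a,b\})$. For subsets $A,B$, $A\leq B$ means $x\leq y$ for all $x\in A,y\in B$; $x+A=\{x+y\mid y\in A\}$. The effect algebra is monotonous if for all $x\in E$ and all non-empty $A,B\subseteq E$: $A\cup B\leq x'$ and $L(A)\leq U(B)$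 imply $L(x+A)\leq U(x+B)$. -}

module Defs where

open import Level using (Level; suc; _⊔_)
open import Data.Maybe using (Maybe; just; nothing; _>>=_)
open import Data.Product using (Σ; ∃; _×_; _,_)
open import Data.Sum using (_⊎_)
open import Relation.Binary.PropositionalEquality using (_≡_)
open import Relation.Unary using (Pred; _∈_)

-- The partial operation + is modelled
-- as a total function into Maybe E:  x + y ≡ just z  means "x + y is
-- defined and equals z";  x + y ≡ nothing  means "x + y is undefined".
record EffectAlgebra (ℓ : Level) : Set (suc ℓ) where
  infixl 6 _+_
  infix 8 _′
  field
    Carrier : Set ℓ
    _+_     : Carrier → Carrier → Maybe Carrier
    _′      : Carrier → Carrier
    𝟘       : Carrier
    𝟙       : Carrier
    E1 : ∀ x y → x + y ≡ y + x
    E2 : ∀ x y z → ((x + y) >>= λ w → w + z) ≡ ((y + z) >>= λ w → x + w)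
    E3-exists : ∀ x → x + (x ′) ≡ just 𝟙
    E3-unique : ∀ x u → x + u ≡ just 𝟙 → u ≡ x ′
    E4 : ∀ x z → 𝟙 + x ≡ just z → x ≡ 𝟘

module EA {ℓ : Level} (𝐄 : EffectAlgebra ℓ) where
  open EffectAlgebra 𝐄

  infix 4 _≤_
  _≤_ : Carrier → Carrier → Set ℓ
  x ≤ y = ∃ λ z → x + z ≡ just y

  L : Pred Carrier ℓ → Pred Carrier ℓ
  L A x = ∀ y → y ∈ A → x ≤ y

  U : Pred Carrier ℓ → Pred Carrier ℓ
  U A x = ∀ y → y ∈ A → y ≤ x

  L₂ : Carrier → Carrier → Pred Carrier ℓ
  L₂ a b x = x ≤ a × x ≤ b

  _≤ˢ_ : Pred Carrier ℓ → Pred Carrier ℓ → Set ℓ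
  A ≤ˢ B = ∀ x y → x ∈ A → y ∈ B → x ≤ y

  _+ˢ_ : Carrier → Pred Carrier ℓ → Pred Carrier ℓ
  (x +ˢ A) z = ∃ λ y → y ∈ A × x + y ≡ just z

  NonEmpty : Pred Carrier ℓ → Set ℓ
  NonEmpty A = ∃ λ a → a ∈ A

  Monotonous : Set (suc ℓ)
  Monotonous = ∀ (x : Carrier) (A B : Pred Carrier ℓ) →
    NonEmpty A → NonEmpty B →
    (∀ y → (y ∈ A ⊎ y ∈ B) → y ≤ x ′) →
    L A ≤ˢ U B →
    L (x +ˢ A) ≤ˢ U (x +ˢ B)

  -- ℂ(𝐄): x ⊙ y := (x′ + y′)′, defined iff x′ ≤ y.
  -- ⊙[ x , y ]≔ z  means "x ⊙ y is defined and equals z".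
  ⊙[_,_]≔_ : Carrier → Carrier → Carrier → Set ℓ
  ⊙[ x , y ]≔ z = x ′ ≤ y × (∃ λ w → x ′ + y ′ ≡ just w × z ≡ w ′)

  -- x → y := { x′ + u | u ∈ L(x,y) }  (part of ℂ(𝐄), not needed below)
  ⇒ : Carrier → Carrier → Pred Carrier ℓ
  ⇒ x y z = ∃ λ u → u ∈ L₂ x y × x ′ + u ≡ just z

  ⊕[_,_]≔_ : Carrier → Carrier → Carrier → Set ℓ
  ⊕[ x , y ]≔ z = x ≤ y ′ × (∃ λ w → ⊙[ x ′ , y ′ ]≔ w × z ≡ w ′)

-- The only real point is that
-- a + b = z forces a ≤ b′, witnessed by a + z′ = b′, which follows from
-- b + (a + z′) = (b + a) + z′ = z + z′ = 1.
module Submission where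

open import Defs
open import Level using (Level)
open import Data.Maybe using (Maybe; just; nothing; _>>=_)
open import Data.Product using (∃; _×_; _,_)
open import Relation.Binary.PropositionalEquality
  using (_≡_; refl; sym; trans; cong; cong₂; subst; subst₂; module ≡-Reasoning)
open import Function.Bundles using (_⇔_; mk⇔)

>>=-just-inv : ∀ {a b} {A : Set a} {B : Set b} {m : Maybe A} {f : A → Maybe B} {y} →
               (m >>= f) ≡ just y → ∃ λ x → m ≡ just x × f x ≡ just y
>>=-just-inv {m = just x} fx≡y = x , refl , fx≡y

module EffectAlgebraProperties {ℓ : Level} (𝐄 : EffectAlgebra ℓ) where
  open EffectAlgebra 𝐄
  open EA 𝐄

  ′-involutive : ∀ x → x ′ ′ ≡ x
  ′-involutive x = sym (E3-unique (x ′) x (trans (E1 (x ′) x) (E3-exists x)))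

  +-complement-sum : ∀ {a b z} → a + b ≡ just z → a + z ′ ≡ just (b ′)
  +-complement-sum {a} {b} {z} a+b≡z
    with >>=-just-inv b+[a+z′]≡𝟙
    where
    open ≡-Reasoning
    b+[a+z′]≡𝟙 : ((a + z ′) >>= λ w → b + w) ≡ just 𝟙
    b+[a+z′]≡𝟙 = begin
      ((a + z ′) >>= λ w → b + w) ≡⟨ sym (E2 b a (z ′)) ⟩
      ((b + a) >>= λ w → w + z ′) ≡⟨ cong (_>>= λ w → w + z ′) (trans (E1 b a) a+b≡z) ⟩
      z + z ′                     ≡⟨ E3-exists z ⟩
      just 𝟙                      ∎
  ... | t , a+z′≡t , b+t≡𝟙 = trans a+z′≡t (cong just (E3-unique b t b+t≡𝟙))

  +-defined⇒≤′ : ∀ {a b z} → a + b ≡ just z → a ≤ b ′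
  +-defined⇒≤′ {z = z} a+b≡z = z ′ , +-complement-sum a+b≡z

  ⊕⇒+ : ∀ {a b z} → ⊕[ a , b ]≔ z → a + b ≡ just z
  ⊕⇒+ {a} {b} {z} (_ , w , (_ , v , a′′+b′′≡v , w≡v′) , z≡w′) =
    subst₂ (λ s t → s ≡ just t) (cong₂ _+_ (′-involutive a) (′-involutive b)) v≡z a′′+b′′≡v
    where
    v≡z : v ≡ z
    v≡z = sym (trans z≡w′ (trans (cong _′ w≡v′) (′-involutive v)))

  +⇒⊕ : ∀ {a b z} → a + b ≡ just z → ⊕[ a , b ]≔ z
  +⇒⊕ {a} {b} {z} a+b≡z =
    a≤b′ , z ′ , (subst (_≤ b ′) (sym (′-involutive a)) a≤b′ , z , a′′+b′′≡z , refl) , sym (′-involutive z)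
    where
    a≤b′ : a ≤ b ′
    a≤b′ = +-defined⇒≤′ a+b≡z
    a′′+b′′≡z : a ′ ′ + b ′ ′ ≡ just z
    a′′+b′′≡z = subst (_≡ just z) (cong₂ _+_ (sym (′-involutive a)) (sym (′-involutive b))) a+b≡z

theorem3 : {ℓ : Level} (𝐄 : EffectAlgebra ℓ) → EA.Monotonous 𝐄 →
    ∀ (a b : EffectAlgebra.Carrier 𝐄) →
      ((∃ λ z → EA.⊕[_,_]≔_ 𝐄 a b z) ⇔ (∃ λ z → EffectAlgebra._+_ 𝐄 a b ≡ just z))
      × (∀ z → EA.⊕[_,_]≔_ 𝐄 a b z → EffectAlgebra._+_ 𝐄 a b ≡ just z)
theorem3 𝐄 _ a b =
  mk⇔ (λ (z , a⊕b≡z) → z , ⊕⇒+ a⊕b≡z) (λ (z , a+b≡z) → z , +⇒⊕ a+b≡z) , λ _ → ⊕⇒+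
  where open EffectAlgebraProperties 𝐄
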